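{- For every $k\in\mathbb{N}$ and $\delta>0$ there exists an integer $B=B(k,\delta)$ such that in the labeled directed graph $L_{k,B}$ defined in the context, every subset $S\subseteq[B]^k$ with $|S|\ge\delta B^k$ contains the vertices of a directed cycle of length $k$ that has exactly one edge of each color $1,\dots,k$.
   Context: For integers $k,B$, let $L_{k,B}$ be the directed graph with vertex set $[B]^k$ and edges colored by $[k]$, where indices are taken cyclically modulo $k$ in $[k]$: for each $i\in[k]$, each $(x_1,\dots,x_k)\in[B]^k$ and each $y_i>x_i$, $y_{i+1}>x_{i+1}$, there is an edge of color $i$ from the vertex obtained from $x$ by replacing coordinate $i+1$ with $y_{i+1}$ to the vertex obtained from $x$ by replacing coordinate $i$ with $y_i$ (all other coordinates equal to those of $x$). Thus an edge of color $i$ strictly increases the $i$th coordinate, strictly decreases the $(i+1)$th coordinate, and leaves the others unchanged. -}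

module Defs where

open import Data.Nat using (ℕ; zero; suc)
open import Data.Nat.DivMod using (_mod_)
open import Data.Fin using (Fin; toℕ) renaming (_<_ to _<ᶠ_)
open import Data.Vec using (Vec; lookup; _[_]≔_)
open import Data.List using (List)
open import Data.List.Membership.Propositional using (_∈_)
open import Data.Product using (Σ; ∃; _×_; _,_)
open import Relation.Binary.PropositionalEquality using (_≡_)
open import Function.Definitions using (Injective; Bijective)

-- Vertices of L_{k,B}: elements of [B]^k, with [B] realised as Fin B
-- (order-isomorphic to {1,…,B}).
Vertex : ℕ → ℕ → Set
Vertex k B = Vec (Fin B) k

next : {k : ℕ} → Fin k → Fin k
next {suc n} i = suc (toℕ i) mod suc n

Edge : (k B : ℕ) → Fin k → Vertex k B → Vertex k B → Set
Edge k B i u v =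
  Σ (Vertex k B) λ x → Σ (Fin B) λ yi → Σ (Fin B) λ yi1 →
    (lookup x i <ᶠ yi) × (lookup x (next i) <ᶠ yi1) ×
    (u ≡ (x [ next i ]≔ yi1)) × (v ≡ (x [ i ]≔ yi))

RainbowCycleIn : (k B : ℕ) → List (Vertex k B) → Set
RainbowCycleIn k B S =
  Σ (Fin k → Vertex k B) λ w → Σ (Fin k → Fin k) λ c →
    Injective _≡_ _≡_ w × Bijective _≡_ _≡_ c ×
    (∀ j → w j ∈ S) × (∀ j → Edge k B (c j) (w j) (w (next j)))

-- Call a vertex s a centre of S if for every coordinate j some vertex of S is
-- obtained from s by lowering coordinate j.  The k lowerings of a centre form a
-- rainbow cycle: the edge of colour j from s[j ↦ t_j] to s[j+1 ↦ t_{j+1}] is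
-- witnessed by x = s[j ↦ t_j, j+1 ↦ t_{j+1}].  If no element of S
-- is a centre, every s ∈ S is the lowest point of S on some line in a direction
-- j, and s ↦ (j, s without coordinate j) is injective, so |S| ≤ k B^(k-1).
-- Hence B > k/δ suffices.
module Submission where

open import Defs
open import Data.Nat using (ℕ; _^_)
open import Data.Integer using (+_)
open import Data.Rational using (ℚ; 0ℚ; _<_; _≤_; _*_; _/_)
open import Data.List using (List; length)
open import Data.List.Relation.Unary.Unique.Propositional using (Unique)
open import Data.Product using (Σ)

open import Data.Nat as ℕ using (zero; suc)
import Data.Nat.Properties as ℕP
open import Data.Nat.DivMod using (_%_; n%n≡0; m<n⇒m%n≡m; m%n<n)
open import Data.Nat.Coprimality as Coprime using (1-coprimeTo)
import Data.Integer as ℤ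
import Data.Integer.Properties as ℤP
open import Data.Rational using (mkℚ; ↧ₙ_; *<*)
import Data.Rational.Properties as ℚP
import Data.Rational.Unnormalised as ℚᵘ
import Data.Rational.Unnormalised.Properties as ℚᵘP
open import Data.Fin as Fin using (Fin; toℕ) renaming (_<_ to _<ᶠ_)
import Data.Fin.Properties as FinP
open import Data.Vec using (Vec; []; _∷_; lookup; _[_]≔_; removeAt; insertAt)
import Data.Vec.Properties as VecP
open import Data.List as List using ([]; _∷_; _++_; cartesianProductWith; filter; allFin)
import Data.List.Properties as ListP
open import Data.List.Membership.Propositional using (_∈_; find; lose)
import Data.List.Membership.Propositional.Properties as ∈P
import Data.List.Membership.DecPropositional as DecMembership
open import Data.List.Relation.Unary.Any as Any using (here; there; any?)
import Data.List.Relation.Unary.Any.Properties as AnyP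
import Data.List.Relation.Unary.All as All
open import Data.List.Relation.Unary.AllPairs using (_∷_)
open import Data.Product using (_×_; _,_; ∃; proj₁; proj₂)
import Data.Product.Properties as ×P
open import Data.Sum using (inj₁; inj₂)
open import Data.Empty using (⊥-elim)
open import Function using (id; _∘_)
open import Function.Definitions using (Injective)
import Function.Construct.Identity as Identity
open import Relation.Binary.Definitions using (DecidableEquality; tri<; tri≈; tri>)
open import Relation.Binary.PropositionalEquality
open import Relation.Nullary using (¬_; Dec; yes; no; ¬?)
open import Relation.Nullary.Decidable using (_×-dec_)

+n/1≡mkℚ : ∀ n → + n / 1 ≡ mkℚ (+ n) 0 (Coprime.sym (1-coprimeTo n))
+n/1≡mkℚ n = ℚP.normalize-coprime (Coprime.sym (1-coprimeTo n))

-- Cross-multiplying, ↥ δ · M ≤ L · ↧ δ, and ↥ δ ≥ 1.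
density⇒bound : ∀ (δ : ℚ) (M L : ℕ) → 0ℚ < δ → δ * (+ M / 1) ≤ + L / 1 →
                M ℕ.≤ L ℕ.* ↧ₙ δ
density⇒bound (mkℚ (+ zero) _ _) M L (*<* (ℤ.+<+ ())) _
density⇒bound δ@(mkℚ (+ suc a) d _) M L _ δM≤L
  with ℚᵘP.≤-respˡ-≃ (ℚP.toℚᵘ-homo-* δ (+ M / 1)) (ℚP.toℚᵘ-mono-≤ δM≤L)
... | δM≤Lᵘ rewrite +n/1≡mkℚ M | +n/1≡mkℚ L with δM≤Lᵘ
... | ℚᵘ.*≤* ≤ᶻ rewrite ℤP.+◃n≡+n (M ℕ.+ a ℕ.* M) | ℤP.*-identityʳ (+ (M ℕ.+ a ℕ.* M))
                       | sym (ℤP.pos-* L (suc (d ℕ.* 1))) | ℕP.*-identityʳ d =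
  ℕP.≤-trans (ℕP.m≤m+n M (a ℕ.* M)) (ℤP.drop‿+≤+ ≤ᶻ)

module _ {A C : Set} (_≟_ : DecidableEquality C) where

  Unique-length-≤ : (Code : A → C → Set) (xs : List A) (ys : List C) → Unique xs →
    (∀ {x} → x ∈ xs → ∃ λ c → Code x c × c ∈ ys) →
    (∀ {x y c} → x ∈ xs → y ∈ xs → Code x c → Code y c → x ≡ y) →
    length xs ℕ.≤ length ys
  Unique-length-≤ Code [] ys _ _ _ = ℕ.z≤n
  Unique-length-≤ Code (x ∷ xs) ys (x∉xs ∷ uniq) code code-injective
    with c , Code-x-c , c∈ys ← code (here refl) =
    ℕP.≤-<-trans (Unique-length-≤ Code xs ys′ uniq code′ (λ p q → code-injective (there p) (there q)))
                 (ListP.filter-notAll (λ y → ¬? (c ≟ y)) ys (Any.map (λ c≡y c≢y → c≢y c≡y) c∈ys))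
    where
    ys′ : List C
    ys′ = filter (λ y → ¬? (c ≟ y)) ys
    code′ : ∀ {y} → y ∈ xs → ∃ λ c′ → Code y c′ × c′ ∈ ys′
    code′ y∈xs with c′ , Code-y-c′ , c′∈ys ← code (there y∈xs) =
      c′ , Code-y-c′ , ∈P.∈-filter⁺ (λ y → ¬? (c ≟ y)) c′∈ys c≢c′
      where
      c≢c′ : c ≢ c′
      c≢c′ refl = All.lookup x∉xs y∈xs
        (sym (code-injective (there y∈xs) (here refl) Code-y-c′ Code-x-c))

length-cartesianProductWith : {A B C : Set} (f : A → B → C) (xs : List A) (ys : List B) →
  length (cartesianProductWith f xs ys) ≡ length xs ℕ.* length ys
length-cartesianProductWith f [] ys = refl
length-cartesianProductWith f (x ∷ xs) ys = begin
  length (List.map (f x) ys ++ cartesianProductWith f xs ys)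
    ≡⟨ ListP.length-++ (List.map (f x) ys) ⟩
  length (List.map (f x) ys) ℕ.+ length (cartesianProductWith f xs ys)
    ≡⟨ cong₂ ℕ._+_ (ListP.length-map (f x) ys) (length-cartesianProductWith f xs ys) ⟩
  length ys ℕ.+ length xs ℕ.* length ys ∎
  where open ≡-Reasoning

∈-cartesianProductWith : {A B C : Set} (f : A → B → C) {x : A} {y : B} {xs : List A} {ys : List B} →
  x ∈ xs → y ∈ ys → f x y ∈ cartesianProductWith f xs ys
∈-cartesianProductWith f = AnyP.cartesianProductWith⁺ f (λ { refl refl → refl })

allVec : (B n : ℕ) → List (Vec (Fin B) n)
allVec B zero    = [] ∷ []
allVec B (suc n) = cartesianProductWith _∷_ (allFin B) (allVec B n)

length-allVec : ∀ B n → length (allVec B n) ≡ B ^ n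
length-allVec B zero    = refl
length-allVec B (suc n) =
  trans (length-cartesianProductWith _∷_ (allFin B) (allVec B n))
        (cong₂ ℕ._*_ (ListP.length-tabulate {n = B} id) (length-allVec B n))

∈-allVec : ∀ {B n} (v : Vec (Fin B) n) → v ∈ allVec B n
∈-allVec []      = here refl
∈-allVec (i ∷ v) = ∈-cartesianProductWith _∷_ (∈P.∈-allFin i) (∈-allVec v)

[]≔≡insertAt-removeAt : ∀ {A : Set} {n} (xs : Vec A (suc n)) (i : Fin (suc n)) (v : A) →
  xs [ i ]≔ v ≡ insertAt (removeAt xs i) i v
[]≔≡insertAt-removeAt (x ∷ xs)     Fin.zero    v = refl
[]≔≡insertAt-removeAt (x ∷ y ∷ xs) (Fin.suc i) v = cong (x ∷_) ([]≔≡insertAt-removeAt (y ∷ xs) i v)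

removeAt-≡⇒[]≔-lookup : ∀ {A : Set} {n} (xs ys : Vec A (suc n)) (i : Fin (suc n)) →
  removeAt xs i ≡ removeAt ys i → xs [ i ]≔ lookup ys i ≡ ys
removeAt-≡⇒[]≔-lookup xs ys i eq = begin
  xs [ i ]≔ lookup ys i                       ≡⟨ []≔≡insertAt-removeAt xs i (lookup ys i) ⟩
  insertAt (removeAt xs i) i (lookup ys i)    ≡⟨ cong (λ r → insertAt r i (lookup ys i)) eq ⟩
  insertAt (removeAt ys i) i (lookup ys i)    ≡⟨ VecP.insertAt-removeAt ys i ⟩
  ys                                          ∎
  where open ≡-Reasoning

suc%≢ : ∀ {i n} → i ℕ.< suc (suc n) → suc i % suc (suc n) ≢ i
suc%≢ {i} {n} i<2+n with ℕP.m≤n⇒m<n∨m≡n i<2+n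
... | inj₁ 1+i<2+n = λ eq → ℕP.1+n≢n (trans (sym (m<n⇒m%n≡m 1+i<2+n)) eq)
... | inj₂ refl    = λ eq → ℕP.0≢1+n (trans (sym (n%n≡0 (suc i))) eq)

next≢ : ∀ {n} (j : Fin (suc (suc n))) → next j ≢ j
next≢ {n} j next≡j = suc%≢ (FinP.toℕ<n j)
  (trans (sym (FinP.toℕ-fromℕ< (m%n<n (suc (toℕ j)) (suc (suc n))))) (cong toℕ next≡j))

lowerings-edge : ∀ {k B} (i : Fin k) → next i ≢ i → (s : Vertex k B) {a b : Fin B} →
  a <ᶠ lookup s i → b <ᶠ lookup s (next i) →
  Edge k B i (s [ i ]≔ a) (s [ next i ]≔ b)
lowerings-edge {k} {B} i i′≢i s {a} {b} a<sᵢ b<sᵢ′ =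
  x , lookup s i , lookup s i′ , xᵢ<sᵢ , xᵢ′<sᵢ′ , sym raise-i′ , sym raise-i
  where
  open ≡-Reasoning
  i′ = next i
  x : Vertex k B
  x = (s [ i ]≔ a) [ i′ ]≔ b
  xᵢ<sᵢ : lookup x i <ᶠ lookup s i
  xᵢ<sᵢ = subst (_<ᶠ lookup s i)
    (sym (trans (VecP.lookup∘update′ (i′≢i ∘ sym) (s [ i ]≔ a) b) (VecP.lookup∘update i s a))) a<sᵢ
  xᵢ′<sᵢ′ : lookup x i′ <ᶠ lookup s i′
  xᵢ′<sᵢ′ = subst (_<ᶠ lookup s i′) (sym (VecP.lookup∘update i′ (s [ i ]≔ a) b)) b<sᵢ′
  raise-i′ : x [ i′ ]≔ lookup s i′ ≡ s [ i ]≔ a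
  raise-i′ = begin
    x [ i′ ]≔ lookup s i′                     ≡⟨ VecP.[]≔-idempotent (s [ i ]≔ a) i′ ⟩
    (s [ i ]≔ a) [ i′ ]≔ lookup s i′          ≡⟨ cong ((s [ i ]≔ a) [ i′ ]≔_) (sym (VecP.lookup∘update′ i′≢i s a)) ⟩
    (s [ i ]≔ a) [ i′ ]≔ lookup (s [ i ]≔ a) i′ ≡⟨ VecP.[]≔-lookup (s [ i ]≔ a) i′ ⟩
    s [ i ]≔ a                                ∎
  raise-i : x [ i ]≔ lookup s i ≡ s [ i′ ]≔ b
  raise-i = begin
    x [ i ]≔ lookup s i                       ≡⟨ VecP.[]≔-commutes (s [ i ]≔ a) i′ i i′≢i ⟩
    ((s [ i ]≔ a) [ i ]≔ lookup s i) [ i′ ]≔ b ≡⟨ cong (_[ i′ ]≔ b) (VecP.[]≔-idempotent s i) ⟩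
    (s [ i ]≔ lookup s i) [ i′ ]≔ b           ≡⟨ cong (_[ i′ ]≔ b) (VecP.[]≔-lookup s i) ⟩
    s [ i′ ]≔ b                               ∎

module Centre {m B : ℕ} (S : List (Vertex (suc m) B)) where

  k = suc m

  Lowerable : Vertex k B → Fin k → Set
  Lowerable s j = ∃ λ t → t <ᶠ lookup s j × s [ j ]≔ t ∈ S

  IsCentre : Vertex k B → Set
  IsCentre s = ∀ j → Lowerable s j

  lowerable? : ∀ s j → Dec (Lowerable s j)
  lowerable? s j = FinP.any? λ t → (t FinP.<? lookup s j) ×-dec (s [ j ]≔ t ∈? S)
    where open DecMembership (VecP.≡-dec FinP._≟_) using (_∈?_)

  isCentre? : ∀ s → Dec (IsCentre s)
  isCentre? s = FinP.all? (lowerable? s)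

  lowest-on-line-unique : ∀ {x y j} → x ∈ S → y ∈ S → ¬ Lowerable x j → ¬ Lowerable y j →
    removeAt x j ≡ removeAt y j → x ≡ y
  lowest-on-line-unique {x} {y} {j} x∈S y∈S x-lowest y-lowest same-line
    with FinP.<-cmp (lookup x j) (lookup y j)
  ... | tri< xⱼ<yⱼ _ _ = ⊥-elim (y-lowest (lookup x j , xⱼ<yⱼ ,
          subst (_∈ S) (sym (removeAt-≡⇒[]≔-lookup y x j (sym same-line))) x∈S))
  ... | tri> _ _ yⱼ<xⱼ = ⊥-elim (x-lowest (lookup y j , yⱼ<xⱼ ,
          subst (_∈ S) (sym (removeAt-≡⇒[]≔-lookup x y j same-line)) y∈S))
  ... | tri≈ _ xⱼ≡yⱼ _ = begin
    x                      ≡⟨ sym (removeAt-≡⇒[]≔-lookup y x j (sym same-line)) ⟩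
    y [ j ]≔ lookup x j    ≡⟨ cong (y [ j ]≔_) xⱼ≡yⱼ ⟩
    y [ j ]≔ lookup y j    ≡⟨ VecP.[]≔-lookup y j ⟩
    y                      ∎
    where open ≡-Reasoning

  no-centre⇒length≤ : Unique S → (∀ {s} → s ∈ S → ¬ IsCentre s) → length S ℕ.≤ k ℕ.* B ^ m
  no-centre⇒length≤ uniq no-centre = subst (length S ℕ.≤_) length-codes
    (Unique-length-≤ codeDec Code S codes uniq code
      (λ { x∈S y∈S (x-lowest , refl) (y-lowest , same-line) →
             lowest-on-line-unique x∈S y∈S x-lowest y-lowest (sym same-line) }))
    where
    codes : List (Fin k × Vec (Fin B) m)
    codes = cartesianProductWith _,_ (allFin k) (allVec B m)
    length-codes : length codes ≡ k ℕ.* B ^ m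
    length-codes = trans (length-cartesianProductWith _,_ (allFin k) (allVec B m))
      (cong₂ ℕ._*_ (ListP.length-tabulate {n = k} id) (length-allVec B m))
    codeDec : DecidableEquality (Fin k × Vec (Fin B) m)
    codeDec = ×P.≡-dec FinP._≟_ (VecP.≡-dec FinP._≟_)
    Code : Vertex k B → Fin k × Vec (Fin B) m → Set
    Code s (j , r) = ¬ Lowerable s j × removeAt s j ≡ r
    code : ∀ {s} → s ∈ S → ∃ λ c → Code s c × c ∈ codes
    code {s} s∈S with j , s-lowest ← FinP.¬∀⟶∃¬ k _ (lowerable? s) (no-centre s∈S) =
      (j , removeAt s j) , (s-lowest , refl) ,
      ∈-cartesianProductWith _,_ (∈P.∈-allFin j) (∈-allVec (removeAt s j))

-- For k = 1 the cycle is a loop at s itself, witnessed by x = the lowering of s.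
centre⇒rainbowCycle : ∀ {m B} (S : List (Vertex (suc m) B)) {s} → s ∈ S → Centre.IsCentre S s →
                      RainbowCycleIn (suc m) B S
centre⇒rainbowCycle {zero} S {a ∷ []} s∈S centre with t , t<a , _ ← centre Fin.zero =
  (λ _ → a ∷ []) , id , (λ { {Fin.zero} {Fin.zero} _ → refl }) , Identity.bijective _≡_ ,
  (λ _ → s∈S) , λ { Fin.zero → (t ∷ []) , a , a , t<a , t<a , refl , refl }
centre⇒rainbowCycle {suc n} {B} S {s} _ centre =
  lowering , id , lowering-injective , Identity.bijective _≡_ , (λ j → proj₂ (proj₂ (centre j))) ,
  λ j → lowerings-edge j (next≢ j) s (lowered j) (lowered (next j))
  where
  lowering : Fin (suc (suc n)) → Vertex (suc (suc n)) B
  lowering j = s [ j ]≔ proj₁ (centre j)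
  lowered : ∀ j → proj₁ (centre j) <ᶠ lookup s j
  lowered j = proj₁ (proj₂ (centre j))
  lowering-injective : Injective _≡_ _≡_ lowering
  lowering-injective {i} {j} eq with i FinP.≟ j
  ... | yes i≡j = i≡j
  ... | no i≢j = ⊥-elim (FinP.<-irrefl tᵢ≡sᵢ (lowered i))
    where
    tᵢ≡sᵢ : proj₁ (centre i) ≡ lookup s i
    tᵢ≡sᵢ = trans (sym (VecP.lookup∘update i s _))
              (trans (cong (λ v → lookup v i) eq) (VecP.lookup∘update′ i≢j s _))

m*n*o<[1+m*o]*n : ∀ m n o → 0 ℕ.< n → m ℕ.* n ℕ.* o ℕ.< suc (m ℕ.* o) ℕ.* n
m*n*o<[1+m*o]*n m n o 0<n = begin-strict
  m ℕ.* n ℕ.* o          ≡⟨ ℕP.*-assoc m n o ⟩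
  m ℕ.* (n ℕ.* o)        ≡⟨ cong (m ℕ.*_) (ℕP.*-comm n o) ⟩
  m ℕ.* (o ℕ.* n)        ≡⟨ ℕP.*-assoc m o n ⟨
  m ℕ.* o ℕ.* n          <⟨ ℕP.m<n+m (m ℕ.* o ℕ.* n) 0<n ⟩
  suc (m ℕ.* o) ℕ.* n    ∎
  where open ℕP.≤-Reasoning

lemma9 : (k : ℕ) (δ : ℚ) → 0ℚ < δ →
    Σ ℕ λ B → (S : List (Vertex k B)) → Unique S →
      δ * (+ (B ^ k) / 1) ≤ (+ (length S) / 1) →
      RainbowCycleIn k B S
lemma9 zero δ _ = 0 , λ _ _ _ →
  (λ ()) , id , (λ {i} → ⊥-elim (FinP.¬Fin0 i)) , Identity.bijective _≡_ , (λ ()) , (λ ())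
lemma9 (suc m) δ 0<δ = B , rainbowCycle
  where
  D = ↧ₙ δ
  B = suc (suc m ℕ.* D)
  rainbowCycle : (S : List (Vertex (suc m) B)) → Unique S →
    δ * (+ (B ^ suc m) / 1) ≤ (+ (length S) / 1) → RainbowCycleIn (suc m) B S
  rainbowCycle S uniq dense with any? (Centre.isCentre? S) S
  ... | yes ∃centre with s , s∈S , centre ← find ∃centre = centre⇒rainbowCycle S s∈S centre
  ... | no ∄centre = ⊥-elim (ℕP.<-irrefl refl (begin-strict
    B ^ suc m              ≤⟨ density⇒bound δ (B ^ suc m) (length S) 0<δ dense ⟩
    length S ℕ.* D         ≤⟨ ℕP.*-monoˡ-≤ D (no-centre⇒length≤ uniq λ s∈S centre → ∄centre (lose s∈S centre)) ⟩
    suc m ℕ.* B ^ m ℕ.* D  <⟨ m*n*o<[1+m*o]*n (suc m) (B ^ m) D (ℕP.m^n>0 B m) ⟩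
    B ^ suc m              ∎))
    where open Centre S
          open ℕP.≤-Reasoning
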